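{- Let $n\ge 3$ be odd and $f\ge 1$ an integer. Then \[ \overrightarrow{\beta}(K_n,f)\le \begin{cases} n-3f & \text{if } f<\frac{n-1}{4},\\ \frac{n-1}{2}-f+1 & \text{if } \frac{n-1}{4}\le f<\frac{n-1}{2},\\ 1 & \text{if } f\ge \frac{n-1}{2}, \end{cases} \] where $K_n$ is the complete graph on $n$ vertices.
   Context: Firefighting on oriented graphs: an orientation $\overrightarrow{G}$ of a finite simple graph $G$ replaces each edge $uv$ by exactly one of the arcs $\overrightarrow{uv}$, $\overrightarrow{vu}$. Let $f\ge 1$ be an integer. A fire breaks out at a vertex $v$ at time $1$ ($v$ burns). At the end of each time unit, the firefighters permanently protect up to $f$ vertices that are neither burning nor already protected. At the next time unit, every vertex that is neither burning nor protected and is an out-neighbour of a burning vertex starts to burn. The process ends when no new vertex can burn. $\beta(\overrightarrow{G},f)$ is the maximum, over all starting vertices $v$, of the minimum, over all protection strategies, of the number of vertices that burn. $\overrightarrow{\beta}(G,f)$ is the minimum of $\beta(\overrightarrow{G},f)$ over all orientations $\overrightarrow{G}$ of $G$. -}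

module Defs where

open import Data.Nat using (ℕ; zero; suc; _+_; _*_; _∸_; _≤_; _<ᵇ_)
open import Data.Nat.DivMod using (_/_)
open import Data.Bool using (Bool; true; false; not; _∧_; _∨_; if_then_else_)
open import Data.Fin using (Fin; _≟_)
open import Data.List using (List; length; filter; allFin)
open import Data.Bool.ListAction using (any)
import Data.Bool.Properties as BoolP
open import Data.Product using (Σ; ∃; _×_)
open import Relation.Nullary using (¬_; does)
open import Relation.Binary.PropositionalEquality using (_≡_; _≢_)
open import Function using (_∘_)

VSet : ℕ → Set
VSet n = Fin n → Bool

∅ : ∀ {n} → VSet n
∅ _ = false

singleton : ∀ {n} → Fin n → VSet n
singleton v u = does (u ≟ v)

_∪_ : ∀ {n} → VSet n → VSet n → VSet n
(A ∪ B) u = A u ∨ B u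

card : ∀ {n} → VSet n → ℕ
card {n} A = length (filter (λ u → A u BoolP.≟ true) (allFin n))

-- An orientation of the complete graph K_n on vertex set Fin n:
-- arc i j = true means the arc i → j is present.
record Orientation (n : ℕ) : Set where
  field
    arc     : Fin n → Fin n → Bool
    noLoop  : ∀ i → arc i i ≡ false
    oneWay  : ∀ i j → i ≢ j → arc j i ≡ not (arc i j)
open Orientation public

record State (n : ℕ) : Set where
  constructor ⟨_,_⟩
  field
    burning   : VSet n
    protected : VSet n
open State public

spread : ∀ {n} → Orientation n → VSet n → VSet n → VSet n
spread {n} D B P u =
  B u ∨ (not (P u) ∧ any (λ w → B w ∧ arc D w u) (allFin n))

-- A protection strategy: the set protected at the end of time unit t+1
-- (t = 0,1,2,...).  Since fire spread is deterministic, adaptive strategies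
-- are the same as fixed sequences.
Strategy : ℕ → Set
Strategy n = ℕ → VSet n

-- state at time t+1 (time 1 = index 0): fire at v, nothing protected.
run : ∀ {n} → Orientation n → Fin n → Strategy n → ℕ → State n
run D v S zero    = ⟨ singleton v , ∅ ⟩
run D v S (suc t) =
  let st = run D v S t
      P′ = protected st ∪ S t
  in ⟨ spread D (burning st) P′ , P′ ⟩

Legal : ∀ {n} → Orientation n → Fin n → ℕ → Strategy n → Set
Legal D v f S = ∀ t →
  card (S t) ≤ f ×
  (∀ u → S t u ≡ true →
     burning (run D v S t) u ≡ false × protected (run D v S t) u ≡ false)

-- β(D, f) ≤ b : from every starting vertex, some legal strategy keeps the
-- total number of burnt vertices at most b.  (The burning set is monotone,
-- so the final number of burnt vertices is ≤ b iff it is ≤ b at every time.)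
βD≤ : ∀ {n} → Orientation n → ℕ → ℕ → Set
βD≤ D f b = ∀ v → Σ (Strategy _) λ S → Legal D v f S × (∀ t → card (burning (run D v S t)) ≤ b)

β→K≤ : ℕ → ℕ → ℕ → Set
β→K≤ n f b = Σ (Orientation n) λ D → βD≤ D f b

-- The bound of Proposition 3.3, for odd n:
--   n - 3f              if f < (n-1)/4   (i.e. 4f < n-1)
--   (n-1)/2 - f + 1     if (n-1)/4 ≤ f < (n-1)/2   (i.e. 2f < n-1)
--   1                   if f ≥ (n-1)/2
bound : ℕ → ℕ → ℕ
bound n f =
  if (4 * f) <ᵇ (n ∸ 1) then n ∸ 3 * f
  else if (2 * f) <ᵇ (n ∸ 1) then ((n ∸ 1) / 2) ∸ f + 1
  else 1

module Submission where

-- The orientation is the circulant tournament on ℤ/n in which i → j iff the forward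
-- distance offset i j from i to j lies in [1, d].  Rotations are automorphisms, so a
-- fire starting at any vertex v can be fought by one schedule written in offsets from v.  Three explicit plans cover the regimes of the bound:
--   f ≥ d                : protect [1, d] at once, only the start burns;
--   d = k + f, k ≤ f     : protect [k+1, d], then [d+1, d+k]; the fire stays in [0, k];
--   d = m + f, m = f + r : protect [m+1, d], [d+1, d+f], [d+m+1, 2d]; the fire ends in
--                          [0, m] ∪ [d+f+1, d+m], i.e. n - 3f vertices.

open import Defs
open import Data.Nat using (ℕ; zero; suc; _+_; _*_; _∸_; _≤_; _<_; z≤n; s≤s; s≤s⁻¹; s<s⁻¹; _≤?_; _≤ᵇ_; _<ᵇ_; _%_; _/_)
open import Data.Nat.DivMod using (m≡m%n+[m/n]*n; m*n/n≡m)
open import Data.Nat.Properties hiding (_≟_)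
open import Data.Nat.Tactic.RingSolver using (solve)
open import Algebra.Properties.CommutativeSemigroup +-commutativeSemigroup using (interchange; xy∙z≈xz∙y)
open import Data.Bool using (Bool; true; false; not; _∧_; _∨_)
open import Data.Bool.Properties using (T-∧; T-∨; T-≡; T-not-≡; ¬-not; ∨-conicalˡ; ∨-conicalʳ; ∨-zeroʳ; _≟_)
open import Data.Bool.ListAction using (any)
open import Data.List using ([]; _∷_; length; filter; tabulate; allFin)
open import Data.List.Relation.Unary.Any using (satisfied)
open import Data.List.Relation.Unary.Any.Properties using (any⁻)
open import Data.Fin using (Fin; zero; suc; toℕ)
open import Data.Fin.Properties using (toℕ<n; toℕ-injective)
import Data.Product
open import Data.Product using (_×_; _,_; proj₁; proj₂; ∃)
import Data.Sum
open import Data.Sum using (_⊎_; inj₁; inj₂)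
open import Data.Empty using (⊥)
open import Relation.Nullary using (yes; no)
open import Relation.Nullary.Negation using (contradiction)
open import Relation.Binary.PropositionalEquality
open import Function using (_∘_; id)
open import Function.Bundles using (Equivalence)
open Equivalence using (to; from)

∨-true : ∀ {a b} → a ∨ b ≡ true → a ≡ true ⊎ b ≡ true
∨-true h = Data.Sum.map (T-≡ .to) (T-≡ .to) (T-∨ .to (T-≡ .from h))

∧-true : ∀ {a b} → a ∧ b ≡ true → a ≡ true × b ≡ true
∧-true h = Data.Product.map (T-≡ .to) (T-≡ .to) (T-∧ .to (T-≡ .from h))

not-true : ∀ {a} → not a ≡ true → a ≡ false
not-true h = T-not-≡ .to (T-≡ .from h)

any-true : ∀ {A : Set} (p : A → Bool) xs → any p xs ≡ true → ∃ λ x → p x ≡ true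
any-true p xs h = Data.Product.map₂ (T-≡ .to) (satisfied (any⁻ p xs (T-≡ .from h)))

within : ℕ → ℕ → ℕ → Bool
within a b x = (a ≤ᵇ x) ∧ (x ≤ᵇ b)

within-intro : ∀ {a b x} → a ≤ x → x ≤ b → within a b x ≡ true
within-intro a≤x x≤b = T-≡ .to (T-∧ .from (≤⇒≤ᵇ a≤x , ≤⇒≤ᵇ x≤b))

within-elim : ∀ {a b x} → within a b x ≡ true → a ≤ x × x ≤ b
within-elim {a} {b} {x} h with T-∧ .to (T-≡ .from h)
... | a≤x , x≤b = ≤ᵇ⇒≤ a x a≤x , ≤ᵇ⇒≤ x b x≤b

within-above : ∀ {a b x} → b < x → within a b x ≡ false
within-above {a} b<x = ¬-not (λ h → <⇒≱ b<x (proj₂ (within-elim {a} h)))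

beyond : ∀ {a b x} → within a b x ≡ false → a ≤ x → b < x
beyond {a} {b} {x} h a≤x with x ≤? b
... | no x≰b = ≰⇒> x≰b
... | yes x≤b = contradiction (trans (sym (within-intro a≤x x≤b)) h) λ ()

ind : Bool → ℕ
ind true  = 1
ind false = 0

ind≤1 : ∀ b → ind b ≤ 1
ind≤1 true  = ≤-refl
ind≤1 false = z≤n

count : (ℕ → Bool) → ℕ → ℕ
count p zero    = 0
count p (suc k) = ind (p 0) + count (p ∘ suc) k

count-cong : ∀ {p q} k → (∀ j → j < k → p j ≡ q j) → count p k ≡ count q k
count-cong zero    _   = refl
count-cong (suc k) p≡q =
  cong₂ _+_ (cong ind (p≡q 0 (s≤s z≤n))) (count-cong k (λ j j<k → p≡q (suc j) (s≤s j<k)))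

count-split : ∀ p a b → count p (a + b) ≡ count p a + count (λ j → p (a + j)) b
count-split p zero    b = refl
count-split p (suc a) b =
  trans (cong (ind (p 0) +_) (count-split (p ∘ suc) a b)) (sym (+-assoc (ind (p 0)) _ _))

count-window : ∀ p a L k → (∀ j → p j ≡ true → a ≤ j × j < a + L) → count p k ≤ L
count-window p a L zero _ = z≤n
count-window p (suc a) L (suc k) inside with p 0 in p0
... | true  = contradiction (proj₁ (inside 0 p0)) λ ()
... | false = count-window (p ∘ suc) a L k
                (λ j pj → let a≤j , j<a+L = inside (suc j) pj in s≤s⁻¹ a≤j , s<s⁻¹ j<a+L)
count-window p zero zero (suc k) inside with p 0 in p0
... | true  = contradiction (proj₂ (inside 0 p0)) λ ()
... | false = count-window (p ∘ suc) zero zero k (λ j pj → contradiction (proj₂ (inside (suc j) pj)) λ ())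
count-window p zero (suc L) (suc k) inside =
  +-mono-≤ (ind≤1 (p 0))
           (count-window (p ∘ suc) zero L k (λ j pj → z≤n , s<s⁻¹ (proj₂ (inside (suc j) pj))))

count-within : ∀ {a b} L k → b < a + L → count (within a b) k ≤ L
count-within {a} {b} L k b<a+L = count-window (within a b) a L k
  (λ j j∈ → let a≤j , j≤b = within-elim {a} j∈ in a≤j , ≤-<-trans j≤b b<a+L)

count-∨ : ∀ p q k → count (λ j → p j ∨ q j) k ≤ count p k + count q k
count-∨ p q zero    = z≤n
count-∨ p q (suc k) = begin
  ind (p 0 ∨ q 0) + count (λ j → p (suc j) ∨ q (suc j)) k
    ≤⟨ +-mono-≤ (ind-∨ (p 0) (q 0)) (count-∨ (p ∘ suc) (q ∘ suc) k) ⟩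
  (ind (p 0) + ind (q 0)) + (count (p ∘ suc) k + count (q ∘ suc) k)
    ≡⟨ interchange (ind (p 0)) (ind (q 0)) _ _ ⟩
  (ind (p 0) + count (p ∘ suc) k) + (ind (q 0) + count (q ∘ suc) k) ∎
  where
  open ≤-Reasoning
  ind-∨ : ∀ a b → ind (a ∨ b) ≤ ind a + ind b
  ind-∨ true  b = s≤s z≤n
  ind-∨ false b = ≤-refl

length-filter-mono : ∀ {A : Set} (p q : A → Bool) xs → (∀ x → p x ≡ true → q x ≡ true) →
  length (filter (λ x → p x ≟ true) xs) ≤ length (filter (λ x → q x ≟ true) xs)
length-filter-mono p q []       p⇒q = z≤n
length-filter-mono p q (x ∷ xs) p⇒q with p x in px | q x in qx
... | true  | true  = s≤s (length-filter-mono p q xs p⇒q)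
... | true  | false = contradiction (trans (sym (p⇒q x px)) qx) λ ()
... | false | true  = m≤n⇒m≤1+n (length-filter-mono p q xs p⇒q)
... | false | false = length-filter-mono p q xs p⇒q

card-mono : ∀ {n} (A B : VSet n) → (∀ u → A u ≡ true → B u ≡ true) → card A ≤ card B
card-mono {n} A B = length-filter-mono A B (allFin n)

filter-tabulate-count : ∀ {k m} (A : VSet m) (g : Fin k → Fin m) (q : ℕ → Bool) →
  (∀ i → A (g i) ≡ q (toℕ i)) → length (filter (λ u → A u ≟ true) (tabulate g)) ≡ count q k
filter-tabulate-count {zero}  A g q A∘g≡q = refl
filter-tabulate-count {suc k} A g q A∘g≡q with A (g zero) | A∘g≡q zero
... | true  | q0 rewrite sym q0 = cong suc (filter-tabulate-count A (g ∘ suc) (q ∘ suc) (A∘g≡q ∘ suc))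
... | false | q0 rewrite sym q0 = filter-tabulate-count A (g ∘ suc) (q ∘ suc) (A∘g≡q ∘ suc)

card-count : ∀ {n} (q : ℕ → Bool) → card {n} (λ u → q (toℕ u)) ≡ count q n
card-count {n} q = filter-tabulate-count {n} _ id q (λ _ → refl)

module Cyclic (n : ℕ) where

  -- Shift a δ x says x ≡ a + δ (mod n), the sum passing around the cycle at most once.
  data Shift (a δ x : ℕ) : Set where
    direct  : a + δ ≡ x     → Shift a δ x
    wrapped : a + δ ≡ x + n → Shift a δ x

  excess : ∀ {a δ x} → Shift a δ x → ℕ
  excess (direct _)  = 0
  excess (wrapped _) = n

  shift-equation : ∀ {a δ x} (s : Shift a δ x) → a + δ ≡ x + excess s
  shift-equation (direct a+δ≡x) = trans a+δ≡x (sym (+-identityʳ _))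
  shift-equation (wrapped a+δ≡x+n) = a+δ≡x+n

  shift-nowrap : ∀ {a δ x} → a + δ < n → Shift a δ x → a + δ ≡ x
  shift-nowrap _       (direct a+δ≡x) = a+δ≡x
  shift-nowrap {x = x} a+δ<n (wrapped a+δ≡x+n) =
    contradiction (subst (n ≤_) (sym a+δ≡x+n) (m≤n+m n x)) (<⇒≱ a+δ<n)

  offset : ℕ → ℕ → ℕ
  offset i j with i ≤? j
  ... | yes _ = j ∸ i
  ... | no  _ = (j + n) ∸ i

  offset-spec : ∀ {i} j → i < n → Shift i (offset i j) j
  offset-spec {i} j i<n with i ≤? j
  ... | yes i≤j = direct (m+[n∸m]≡n i≤j)
  ... | no  _   = wrapped (m+[n∸m]≡n (≤-trans (<⇒≤ i<n) (m≤n+m n j)))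

  offset<n : ∀ {i j} → i < n → j < n → offset i j < n
  offset<n {i} {j} i<n j<n with i ≤? j
  ... | yes _   = ≤-<-trans (m∸n≤m j i) j<n
  ... | no  i≰j = +-cancelˡ-< i _ _ (begin-strict
    i + (j + n ∸ i) ≡⟨ m+[n∸m]≡n (≤-trans (<⇒≤ i<n) (m≤n+m n j)) ⟩
    j + n           <⟨ +-monoˡ-< n (≰⇒> i≰j) ⟩
    i + n           ∎)
    where open ≤-Reasoning

  offset-self : ∀ i → offset i i ≡ 0
  offset-self i with i ≤? i
  ... | yes _   = n∸n≡0 i
  ... | no  i≰i = contradiction ≤-refl i≰i

  offset-positive : ∀ {i j} → i < n → i ≢ j → 0 < offset i j
  offset-positive {i} {j} i<n i≢j =
    n≢0⇒n>0 (λ δ≡0 → no-zero-shift (subst (λ δ → Shift i δ j) δ≡0 (offset-spec j i<n)))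
    where
    no-zero-shift : Shift i 0 j → ⊥
    no-zero-shift (direct i+0≡j)    = i≢j (trans (sym (+-identityʳ i)) i+0≡j)
    no-zero-shift (wrapped i+0≡j+n) =
      <⇒≱ i<n (subst (n ≤_) (trans (sym i+0≡j+n) (+-identityʳ i)) (m≤n+m n j))

  excess-balance : ∀ {v w u a b c x y z} →
    v + a ≡ w + x → w + b ≡ u + y → v + c ≡ u + z → (a + b) + z ≡ c + (x + y)
  excess-balance {v} {w} {u} {a} {b} {c} {x} {y} {z} e₁ e₂ e₃ = +-cancelˡ-≡ (v + w) _ _ (begin
    (v + w) + ((a + b) + z)  ≡⟨ solve (v ∷ w ∷ a ∷ b ∷ z ∷ []) ⟩
    ((v + a) + (w + b)) + z  ≡⟨ cong₂ (λ s t → (s + t) + z) e₁ e₂ ⟩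
    ((w + x) + (u + y)) + z  ≡⟨ solve (w ∷ x ∷ u ∷ y ∷ z ∷ []) ⟩
    (w + (x + y)) + (u + z)  ≡⟨ cong ((w + (x + y)) +_) (sym e₃) ⟩
    (w + (x + y)) + (v + c)  ≡⟨ solve (w ∷ x ∷ y ∷ v ∷ c ∷ []) ⟩
    (v + w) + (c + (x + y))  ∎)
    where open ≡-Reasoning

  compose-shifts : ∀ {v w u a b c} → a < n → b < n → c < n →
    Shift v a w → Shift w b u → Shift v c u → Shift a b c
  compose-shifts {v} {w} {u} {a} {b} {c} a<n b<n c<n s₁ s₂ s₃ =
    by-excess s₁ s₂ s₃ (excess-balance {v} {w} {u} {a} {b} {c}
                          (shift-equation s₁) (shift-equation s₂) (shift-equation s₃))
    where
    by-excess : ∀ {v w u} (s₁ : Shift v a w) (s₂ : Shift w b u) (s₃ : Shift v c u) →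
      (a + b) + excess s₃ ≡ c + (excess s₁ + excess s₂) → Shift a b c
    by-excess (direct _)  (direct _)  (direct _)  bal = direct (+-cancelʳ-≡ 0 _ _ bal)
    by-excess (direct _)  (direct _)  (wrapped _) bal =
      contradiction (subst (n ≤_) (trans bal (+-identityʳ c)) (m≤n+m n (a + b))) (<⇒≱ c<n)
    by-excess (direct _)  (wrapped _) (direct _)  bal = wrapped (trans (sym (+-identityʳ _)) bal)
    by-excess (direct _)  (wrapped _) (wrapped _) bal = direct (+-cancelʳ-≡ n _ _ bal)
    by-excess (wrapped _) (direct _)  (direct _)  bal =
      wrapped (trans (sym (+-identityʳ _)) (trans bal (cong (c +_) (+-identityʳ n))))
    by-excess (wrapped _) (direct _)  (wrapped _) bal =
      direct (+-cancelʳ-≡ n _ _ (trans bal (cong (c +_) (+-identityʳ n))))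
    by-excess (wrapped _) (wrapped _) (direct _)  bal =
      contradiction (subst (n + n ≤_) (trans (sym bal) (+-identityʳ (a + b))) (m≤n+m (n + n) c))
                    (<⇒≱ (+-mono-< a<n b<n))
    by-excess (wrapped _) (wrapped _) (wrapped _) bal =
      wrapped (+-cancelʳ-≡ n _ _ (trans bal (sym (+-assoc c n n))))

  offset-cocycle : ∀ {v w u} → v < n → w < n → u < n → Shift (offset v w) (offset w u) (offset v u)
  offset-cocycle {v} {w} {u} v<n w<n u<n =
    compose-shifts (offset<n v<n w<n) (offset<n w<n u<n) (offset<n v<n u<n)
                   (offset-spec w v<n) (offset-spec u w<n) (offset-spec u v<n)

  offset-opposite : ∀ {i j} → i < n → j < n → i ≢ j → offset i j + offset j i ≡ n
  offset-opposite {i} {j} i<n j<n i≢j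
    with subst (Shift (offset i j) (offset j i)) (offset-self i) (offset-cocycle i<n j<n i<n)
  ... | direct  sum≡0 =
    contradiction (subst (0 <_) sum≡0 (<-≤-trans (offset-positive i<n i≢j) (m≤m+n _ _))) λ ()
  ... | wrapped sum≡n = sum≡n

  offset-shift : ∀ v j → offset v (v + j) ≡ j
  offset-shift v j with v ≤? v + j
  ... | yes _   = m+n∸m≡n v j
  ... | no  v≰v+j = contradiction (m≤m+n v j) v≰v+j

  offset-wrap : ∀ {v j} → j < v → v ≤ n → offset v j ≡ (n ∸ v) + j
  offset-wrap {v} {j} j<v v≤n with v ≤? j
  ... | yes v≤j = contradiction v≤j (<⇒≱ j<v)
  ... | no  _   = trans (cong (_∸ v) (+-comm j n)) (+-∸-comm j v≤n)

  count-rotate : ∀ p {v} → v ≤ n → count (λ u → p (offset v u)) n ≡ count p n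
  count-rotate p {v} v≤n = begin
    count (λ u → p (offset v u)) n
      ≡⟨ cong (count (λ u → p (offset v u))) (sym v+m≡n) ⟩
    count (λ u → p (offset v u)) (v + m)
      ≡⟨ count-split _ v m ⟩
    count (λ u → p (offset v u)) v + count (λ j → p (offset v (v + j))) m
      ≡⟨ cong₂ _+_ (count-cong v (λ j j<v → cong p (offset-wrap j<v v≤n)))
                   (count-cong m (λ j _ → cong p (offset-shift v j))) ⟩
    count (λ j → p (m + j)) v + count p m
      ≡⟨ +-comm _ (count p m) ⟩
    count p m + count (λ j → p (m + j)) v
      ≡⟨ sym (count-split p m v) ⟩
    count p (m + v)
      ≡⟨ cong (count p) (trans (+-comm m v) v+m≡n) ⟩
    count p n ∎
    where
    open ≡-Reasoning
    m = n ∸ v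
    v+m≡n : v + m ≡ n
    v+m≡n = m+[n∸m]≡n v≤n

module Circulant (d : ℕ) where

  n : ℕ
  n = suc (d + d)

  open Cyclic n public

  arcℕ : ℕ → ℕ → Bool
  arcℕ i j = within 1 d (offset i j)

  within-complement : ∀ {a b} → 1 ≤ a → 1 ≤ b → a + b ≡ n → within 1 d b ≡ not (within 1 d a)
  within-complement {a} {b} 1≤a 1≤b a+b≡n with a ≤? d
  ... | yes a≤d rewrite within-intro 1≤a a≤d = within-above {1} d<b
    where
    d<b : d < b
    d<b = +-cancelˡ-< d d b (begin-strict
      d + d  <⟨ ≤-refl ⟩
      n      ≡⟨ sym a+b≡n ⟩
      a + b  ≤⟨ +-monoˡ-≤ b a≤d ⟩
      d + b  ∎)
      where open ≤-Reasoning
  ... | no  a≰d rewrite within-above {1} (≰⇒> a≰d) =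
    within-intro 1≤b
      (+-cancelˡ-≤ (suc d) b d (≤-trans (+-monoˡ-≤ b (≰⇒> a≰d)) (≤-reflexive a+b≡n)))

  -- The circulant tournament is an orientation of K_n: no loops, and each edge gets
  -- exactly one direction because opposite offsets add up to 2d + 1.
  circulant : Orientation n
  circulant = record { arc = λ i j → arcℕ (toℕ i) (toℕ j) ; noLoop = no-loop ; oneWay = one-way }
    where
    no-loop : ∀ i → arcℕ (toℕ i) (toℕ i) ≡ false
    no-loop i rewrite offset-self (toℕ i) = refl
    one-way : ∀ i j → i ≢ j → arcℕ (toℕ j) (toℕ i) ≡ not (arcℕ (toℕ i) (toℕ j))
    one-way i j i≢j = within-complement (offset-positive (toℕ<n i) i≢ⱼ)
                                        (offset-positive (toℕ<n j) (i≢ⱼ ∘ sym))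
                                        (offset-opposite (toℕ<n i) (toℕ<n j) i≢ⱼ)
      where
      i≢ⱼ : toℕ i ≢ toℕ j
      i≢ⱼ = i≢j ∘ toℕ-injective

  protectedBy : (ℕ → ℕ → Bool) → ℕ → ℕ → Bool
  protectedBy s zero    x = false
  protectedBy s (suc t) x = protectedBy s t x ∨ s t x

  unprotected-before : ∀ s {t x} → protectedBy s t x ≡ false → ∀ {t'} → t' < t → s t' x ≡ false
  unprotected-before s {suc t} {x} free {t'} t'<1+t with m≤n⇒m<n∨m≡n (s≤s⁻¹ t'<1+t)
  ... | inj₁ t'<t  = unprotected-before s (∨-conicalˡ _ _ free) t'<t
  ... | inj₂ refl  = ∨-conicalʳ (protectedBy s t x) _ free

  -- A strategy described in offsets from the starting vertex, together with an
  -- over-approximation reach of the burning offsets that is closed under spreading.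
  record ContainmentPlan (f b : ℕ) : Set where
    field
      protect : ℕ → ℕ → Bool   -- offsets protected at the end of time unit t + 1
      reach   : ℕ → ℕ → Bool   -- offsets that may burn at time t + 1
      reach-start  : reach 0 0 ≡ true
      reach-mono   : ∀ t x → reach t x ≡ true → reach (suc t) x ≡ true
      reach-closed : ∀ t a δ x → reach t a ≡ true → 1 ≤ δ → δ ≤ d → x < n → Shift a δ x →
                     protectedBy protect (suc t) x ≡ false → reach (suc t) x ≡ true
      budget       : ∀ t → count (protect t) n ≤ f
      protect-unreached : ∀ t x → protect t x ≡ true → reach t x ≡ false
      protect-fresh     : ∀ t x → protect t x ≡ true → protectedBy protect t x ≡ false
      reach-bound  : ∀ t → count (reach t) n ≤ b

  -- Vertex counts through offsets from a fixed vertex are plain counts (rotation invariance).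
  card-offsets : ∀ (v : Fin n) p → card {n} (λ u → p (offset (toℕ v) (toℕ u))) ≡ count p n
  card-offsets v p = trans (card-count (λ j → p (offset (toℕ v) j))) (count-rotate p (<⇒≤ (toℕ<n v)))

  module Play {f b} (plan : ContainmentPlan f b) (v : Fin n) where
    open ContainmentPlan plan

    off : Fin n → ℕ
    off u = offset (toℕ v) (toℕ u)

    strategy : Strategy n
    strategy t u = protect t (off u)

    state : ℕ → State n
    state = run circulant v strategy

    protected≡ : ∀ t u → protected (state t) u ≡ protectedBy protect t (off u)
    protected≡ zero    u = refl
    protected≡ (suc t) u = cong (_∨ strategy t u) (protected≡ t u)

    burning⇒reach : ∀ t u → burning (state t) u ≡ true → reach t (off u) ≡ true
    -- At time 1 only v burns, at offset 0; afterwards the fire spreads along arcs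
    -- w → u, whose offsets compose by the cocycle law.
    burning⇒reach zero u u≡v with u Data.Fin.≟ v
    ... | yes refl rewrite offset-self (toℕ v) = reach-start
    burning⇒reach (suc t) u burns with ∨-true burns
    ... | inj₁ burnt = reach-mono t _ (burning⇒reach t u burnt)
    ... | inj₂ caught with ∧-true caught
    ... | unprotected , fed with any-true _ (allFin n) fed
    ... | w , w-feeds with ∧-true w-feeds
    ... | w-burns , w→u with within-elim {1} w→u
    ... | 1≤δ , δ≤d =
      reach-closed t _ _ _ (burning⇒reach t w w-burns) 1≤δ δ≤d (offset<n (toℕ<n v) (toℕ<n u))
        (offset-cocycle (toℕ<n v) (toℕ<n w) (toℕ<n u))
        (trans (sym (protected≡ (suc t) u)) (not-true unprotected))

    legal : Legal circulant v f strategy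
    legal t = subst (_≤ f) (sym (card-offsets v (protect t))) (budget t) ,
              λ u chosen → ¬-not (λ burns → contradiction (trans (sym (burning⇒reach t u burns))
                                                                (protect-unreached t _ chosen)) λ ())
                         , trans (protected≡ t u) (protect-fresh t _ chosen)

    bounded : ∀ t → card (burning (state t)) ≤ b
    bounded t = begin
      card (burning (state t))          ≤⟨ card-mono _ _ (burning⇒reach t) ⟩
      card (λ u → reach t (off u))      ≡⟨ card-offsets v (reach t) ⟩
      count (reach t) n                 ≤⟨ reach-bound t ⟩
      b                                 ∎
      where open ≤-Reasoning

  plan→β : ∀ {f b} → ContainmentPlan f b → β→K≤ n f b
  plan→β plan = circulant , λ v → Play.strategy plan v , Play.legal plan v , Play.bounded plan v

module Plans (d : ℕ) where

  open Circulant d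

  step-forward : ∀ {a δ x} → a ≤ d → δ ≤ d → Shift a δ x → a + δ ≡ x
  step-forward a≤d δ≤d = shift-nowrap (s≤s (+-mono-≤ a≤d δ≤d))

  at-origin : ∀ {a} → within 0 0 a ≡ true → a ≡ 0
  at-origin {a} a∈ = n≤0⇒n≡0 (proj₂ (within-elim {0} a∈))

  count-nothing : ∀ f k → count (λ _ → false) k ≤ f
  count-nothing f k = count-window _ 0 f k (λ _ ())

  large-plan : ∀ {f} → d ≤ f → ContainmentPlan f 1
  large-plan {f} d≤f = record
    { protect = protect ; reach = λ _ → within 0 0 ; reach-start = refl ; reach-mono = λ _ _ x∈ → x∈
    ; reach-closed = closed ; budget = budget ; protect-unreached = unreached
    ; protect-fresh = fresh ; reach-bound = λ t → count-within {0} 1 n ≤-refl }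
    where
    protect : ℕ → ℕ → Bool
    protect zero    = within 1 d
    protect (suc _) = λ _ → false

    closed : ∀ t a δ x → within 0 0 a ≡ true → 1 ≤ δ → δ ≤ d → x < n → Shift a δ x →
             protectedBy protect (suc t) x ≡ false → within 0 0 x ≡ true
    closed t a δ x a∈ 1≤δ δ≤d _ shift free with at-origin {a} a∈
    ... | refl with step-forward z≤n δ≤d shift
    ... | refl = contradiction (trans (sym (within-intro 1≤δ δ≤d))
                                      (unprotected-before protect {suc t} {δ} free {0} (s≤s z≤n))) λ ()

    budget : ∀ t → count (protect t) n ≤ f
    budget zero    = ≤-trans (count-within {1} d n ≤-refl) d≤f
    budget (suc t) = count-nothing f n

    unreached : ∀ t x → protect t x ≡ true → within 0 0 x ≡ false
    unreached zero x x∈ = within-above {0} {0} {x} (proj₁ (within-elim {1} {d} {x} x∈))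

    fresh : ∀ t x → protect t x ≡ true → protectedBy protect t x ≡ false
    fresh zero x _ = refl

  medium-plan : ∀ {k f} → d ≡ k + f → k ≤ f → ContainmentPlan f (suc k)
  medium-plan {k} {f} d≡k+f k≤f = record
    { protect = protect ; reach = reach ; reach-start = refl ; reach-mono = mono
    ; reach-closed = closed ; budget = budget ; protect-unreached = unreached
    ; protect-fresh = fresh ; reach-bound = bound′ }
    where
    k≤d : k ≤ d
    k≤d = subst (k ≤_) (sym d≡k+f) (m≤m+n k f)

    protect : ℕ → ℕ → Bool
    protect zero          = within (suc k) d
    protect (suc zero)    = within (suc d) (d + k)
    protect (suc (suc _)) = λ _ → false

    reach : ℕ → ℕ → Bool
    reach zero    = within 0 0
    reach (suc _) = within 0 k

    mono : ∀ t x → reach t x ≡ true → reach (suc t) x ≡ true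
    mono zero    x x∈ rewrite at-origin {x} x∈ = within-intro {0} {k} z≤n z≤n
    mono (suc t) x x∈ = x∈

    past-first : ∀ t x → protectedBy protect (suc t) x ≡ false → k < x → d < x
    past-first t x free k<x = beyond (unprotected-before protect {suc t} {x} free {0} (s≤s z≤n)) k<x

    closed : ∀ t a δ x → reach t a ≡ true → 1 ≤ δ → δ ≤ d → x < n → Shift a δ x →
             protectedBy protect (suc t) x ≡ false → reach (suc t) x ≡ true
    closed t a δ x a∈ _ δ≤d _ shift free with x ≤? k
    ... | yes x≤k = within-intro z≤n x≤k
    closed zero a δ x a∈ _ δ≤d _ shift free | no x≰k with at-origin {a} a∈
    ... | refl = contradiction (subst (_≤ d) (step-forward z≤n δ≤d shift) δ≤d)
                               (<⇒≱ (past-first 0 x free (≰⇒> x≰k)))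
    closed (suc t) a δ x a∈ _ δ≤d _ shift free | no x≰k =
      contradiction x≤d+k (<⇒≱ (beyond second-free (past-first (suc t) x free (≰⇒> x≰k))))
      where
      a≤k : a ≤ k
      a≤k = proj₂ (within-elim {0} {k} {a} a∈)
      x≤d+k : x ≤ d + k
      x≤d+k = subst (_≤ d + k) (step-forward (≤-trans a≤k k≤d) δ≤d shift)
                    (subst (a + δ ≤_) (+-comm k d) (+-mono-≤ a≤k δ≤d))
      second-free : within (suc d) (d + k) x ≡ false
      second-free = unprotected-before protect {suc (suc t)} {x} free {1} (s≤s (s≤s z≤n))

    budget : ∀ t → count (protect t) n ≤ f
    budget zero          = count-within {suc k} f n (s≤s (≤-reflexive d≡k+f))
    budget (suc zero)    = count-within {suc d} f n (s≤s (+-monoʳ-≤ d k≤f))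
    budget (suc (suc t)) = count-nothing f n

    unreached : ∀ t x → protect t x ≡ true → reach t x ≡ false
    unreached zero       x x∈ =
      within-above {0} {0} {x} (≤-trans (s≤s z≤n) (proj₁ (within-elim {suc k} {d} {x} x∈)))
    unreached (suc zero) x x∈ =
      within-above {0} {k} {x} (≤-trans (s≤s k≤d) (proj₁ (within-elim {suc d} {d + k} {x} x∈)))

    fresh : ∀ t x → protect t x ≡ true → protectedBy protect t x ≡ false
    fresh zero       x _  = refl
    fresh (suc zero) x x∈ = within-above {suc k} {d} {x} (proj₁ (within-elim {suc d} {d + k} {x} x∈))

    bound′ : ∀ t → count (reach t) n ≤ suc k
    bound′ zero    = count-within {0} (suc k) n (s≤s z≤n)
    bound′ (suc t) = count-within {0} (suc k) n ≤-refl

  small-plan : ∀ {f r} → d ≡ (f + r) + f → ContainmentPlan f (suc (f + r) + r)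
  small-plan {f} {r} d≡m+f = record
    { protect = protect ; reach = reach ; reach-start = refl ; reach-mono = mono
    ; reach-closed = closed ; budget = budget ; protect-unreached = unreached
    ; protect-fresh = fresh ; reach-bound = bound′ }
    where
    m : ℕ
    m = f + r

    f≤m : f ≤ m
    f≤m = m≤m+n f r

    m≤d : m ≤ d
    m≤d = subst (m ≤_) (sym d≡m+f) (m≤m+n m f)

    protect : ℕ → ℕ → Bool
    protect zero                = within (suc m) d
    protect (suc zero)          = within (suc d) (d + f)
    protect (suc (suc zero))    = within (suc (d + m)) (d + d)
    protect (suc (suc (suc _))) = λ _ → false

    reach : ℕ → ℕ → Bool
    reach zero          = within 0 0
    reach (suc zero)    = within 0 m
    reach (suc (suc _)) = λ x → within 0 m x ∨ within (suc (d + f)) (d + m) x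

    low-reached : ∀ t x → x ≤ m → reach (suc t) x ≡ true
    low-reached zero    x x≤m = within-intro z≤n x≤m
    low-reached (suc t) x x≤m rewrite within-intro {0} {m} {x} z≤n x≤m = refl

    high-reached : ∀ t x → d + f < x → x ≤ d + m → reach (suc (suc t)) x ≡ true
    high-reached t x d+f<x x≤d+m =
      trans (cong (within 0 m x ∨_) (within-intro d+f<x x≤d+m)) (∨-zeroʳ _)

    mono : ∀ t x → reach t x ≡ true → reach (suc t) x ≡ true
    mono zero          x x∈ rewrite at-origin {x} x∈ = low-reached 0 0 z≤n
    mono (suc zero)    x x∈ = low-reached 1 x (proj₂ (within-elim {0} {m} {x} x∈))
    mono (suc (suc t)) x x∈ = x∈

    past-first : ∀ t x → protectedBy protect (suc t) x ≡ false → m < x → d < x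
    past-first t x free m<x = beyond (unprotected-before protect {suc t} {x} free {0} (s≤s z≤n)) m<x

    past-second : ∀ t x → protectedBy protect (suc (suc t)) x ≡ false → m < x → d + f < x
    past-second t x free m<x =
      beyond (unprotected-before protect {suc (suc t)} {x} free {1} (s≤s (s≤s z≤n)))
             (past-first (suc t) x free m<x)

    closed : ∀ t a δ x → reach t a ≡ true → 1 ≤ δ → δ ≤ d → x < n → Shift a δ x →
             protectedBy protect (suc t) x ≡ false → reach (suc t) x ≡ true
    closed t a δ x a∈ _ δ≤d x<n shift free with x ≤? m
    ... | yes x≤m = low-reached t x x≤m
    closed zero a δ x a∈ _ δ≤d x<n shift free | no x≰m with at-origin {a} a∈
    ... | refl = contradiction (subst (_≤ d) (step-forward z≤n δ≤d shift) δ≤d)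
                               (<⇒≱ (past-first 0 x free (≰⇒> x≰m)))
    closed (suc zero) a δ x a∈ _ δ≤d x<n shift free | no x≰m =
      high-reached 0 x (past-second 0 x free (≰⇒> x≰m)) x≤d+m
      where
      a≤m : a ≤ m
      a≤m = proj₂ (within-elim {0} {m} {a} a∈)
      x≤d+m : x ≤ d + m
      x≤d+m = subst (_≤ d + m) (step-forward (≤-trans a≤m m≤d) δ≤d shift)
                    (subst (a + δ ≤_) (+-comm m d) (+-mono-≤ a≤m δ≤d))
    closed (suc (suc t)) a δ x a∈ _ δ≤d x<n shift free | no x≰m with x ≤? d + m
    ... | yes x≤d+m = high-reached (suc t) x (past-second (suc t) x free (≰⇒> x≰m)) x≤d+m
    ... | no  x≰d+m = contradiction (s≤s⁻¹ x<n) (<⇒≱ (beyond third-free (≰⇒> x≰d+m)))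
      where
      third-free : within (suc (d + m)) (d + d) x ≡ false
      third-free = unprotected-before protect {suc (suc (suc t))} {x} free {2} (s≤s (s≤s (s≤s z≤n)))

    budget : ∀ t → count (protect t) n ≤ f
    budget zero                = count-within {suc m} f n (s≤s (≤-reflexive d≡m+f))
    budget (suc zero)          = count-within {suc d} f n ≤-refl
    budget (suc (suc zero))    = count-within {suc (d + m)} f n
      (s≤s (≤-reflexive (trans (cong (d +_) d≡m+f) (sym (+-assoc d m f)))))
    budget (suc (suc (suc t))) = count-nothing f n

    third-start : ∀ x → protect 2 x ≡ true → d + m < x
    third-start x x∈ = proj₁ (within-elim {suc (d + m)} {d + d} {x} x∈)

    unreached : ∀ t x → protect t x ≡ true → reach t x ≡ false
    unreached zero x x∈ =
      within-above {0} {0} {x} (≤-trans (s≤s z≤n) (proj₁ (within-elim {suc m} {d} {x} x∈)))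
    unreached (suc zero) x x∈ =
      within-above {0} {m} {x} (≤-trans (s≤s m≤d) (proj₁ (within-elim {suc d} {d + f} {x} x∈)))
    unreached (suc (suc zero)) x x∈
      rewrite within-above {0} {m} {x} (≤-trans (s≤s (m≤n+m m d)) (third-start x x∈))
            | within-above {suc (d + f)} {d + m} {x} (third-start x x∈) = refl

    fresh : ∀ t x → protect t x ≡ true → protectedBy protect t x ≡ false
    fresh zero       x _  = refl
    fresh (suc zero) x x∈ = within-above {suc m} {d} {x} (proj₁ (within-elim {suc d} {d + f} {x} x∈))
    fresh (suc (suc zero)) x x∈
      rewrite within-above {suc m} {d} {x} (≤-trans (s≤s (m≤m+n d m)) (third-start x x∈))
            | within-above {suc d} {d + f} {x}
                (≤-trans (s≤s (+-monoʳ-≤ d f≤m)) (third-start x x∈)) = refl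

    bound′ : ∀ t → count (reach t) n ≤ suc m + r
    bound′ zero          = count-within {0} (suc m + r) n (s≤s z≤n)
    bound′ (suc zero)    = ≤-trans (count-within {0} (suc m) n ≤-refl) (m≤m+n (suc m) r)
    bound′ (suc (suc t)) = ≤-trans (count-∨ (within 0 m) (within (suc (d + f)) (d + m)) n)
      (+-mono-≤ (count-within {0} (suc m) n ≤-refl)
                (count-within {suc (d + f)} r n (s≤s (≤-reflexive (sym (+-assoc d f r))))))

halve-< : ∀ {a b} → a + a < b + b → a < b
halve-< a+a<b+b = ≰⇒> (λ b≤a → <⇒≱ a+a<b+b (+-mono-≤ b≤a b≤a))

halve-≤ : ∀ {a b} → a + a ≤ b + b → a ≤ b
halve-≤ a+a≤b+b = ≮⇒≥ (λ b<a → <⇒≱ (+-mono-< b<a b<a) a+a≤b+b)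

<ᵇ-true : ∀ {a b} → (a <ᵇ b) ≡ true → a < b
<ᵇ-true {a} {b} a<ᵇb = <ᵇ⇒< a b (T-≡ .from a<ᵇb)

<ᵇ-false : ∀ {a b} → (a <ᵇ b) ≡ false → b ≤ a
<ᵇ-false a≮ᵇb = ≮⇒≥ (λ a<b → contradiction (trans (sym (T-≡ .to (<⇒<ᵇ a<b))) a≮ᵇb) λ ())

double : ∀ m → 2 * m ≡ m + m
double m = cong (m +_) (+-identityʳ m)

quadruple : ∀ m → 4 * m ≡ (m + m) + (m + m)
quadruple m = solve (m ∷ [])

data Regime (d f : ℕ) : Set where
  small  : ∀ r → d ≡ (f + r) + f → bound (suc (d + d)) f ≡ suc (f + r) + r → Regime d f
  medium : ∀ k → d ≡ k + f → k ≤ f → bound (suc (d + d)) f ≡ suc k → Regime d f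
  large  : d ≤ f → bound (suc (d + d)) f ≡ 1 → Regime d f

small-regime : ∀ {d f} → (4 * f <ᵇ d + d) ≡ true → Regime d f
small-regime {d} {f} 4f<ᵇ2d = small r d≡f+r+f (begin
  bound (suc (d + d)) f                      ≡⟨ bound-here ⟩
  suc (d + d) ∸ 3 * f                        ≡⟨ cong (λ e → suc (e + e) ∸ 3 * f) d≡f+r+f ⟩
  suc (((f + r) + f) + ((f + r) + f)) ∸ 3 * f ≡⟨ cong (_∸ 3 * f) (regroup f r) ⟩
  (3 * f + (suc (f + r) + r)) ∸ 3 * f        ≡⟨ m+n∸m≡n (3 * f) _ ⟩
  suc (f + r) + r                            ∎)
  where
  open ≡-Reasoning
  regroup : ∀ a b → suc (((a + b) + a) + ((a + b) + a)) ≡ 3 * a + (suc (a + b) + b)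
  regroup a b = solve (a ∷ b ∷ [])
  bound-here : bound (suc (d + d)) f ≡ suc (d + d) ∸ 3 * f
  bound-here rewrite 4f<ᵇ2d = refl
  2f<d : f + f < d
  2f<d = halve-< {f + f} (subst (_< d + d) (quadruple f) (<ᵇ-true 4f<ᵇ2d))
  r : ℕ
  r = d ∸ (f + f)
  d≡f+r+f : d ≡ (f + r) + f
  d≡f+r+f = trans (sym (m+[n∸m]≡n (<⇒≤ 2f<d))) (xy∙z≈xz∙y f f r)

medium-regime : ∀ {d f} → (4 * f <ᵇ d + d) ≡ false → (2 * f <ᵇ d + d) ≡ true → Regime d f
medium-regime {d} {f} 4f≮ᵇ2d 2f<ᵇ2d = medium k d≡k+f k≤f (begin
  bound (suc (d + d)) f   ≡⟨ bound-here ⟩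
  (d + d) / 2 ∸ f + 1     ≡⟨ cong (λ e → e / 2 ∸ f + 1) (sym (trans (*-comm d 2) (double d))) ⟩
  (d * 2) / 2 ∸ f + 1     ≡⟨ cong (λ e → e ∸ f + 1) (m*n/n≡m d 2) ⟩
  k + 1                   ≡⟨ +-comm k 1 ⟩
  suc k                   ∎)
  where
  open ≡-Reasoning
  bound-here : bound (suc (d + d)) f ≡ (d + d) / 2 ∸ f + 1
  bound-here rewrite 4f≮ᵇ2d | 2f<ᵇ2d = refl
  f<d : f < d
  f<d = halve-< {f} (subst (_< d + d) (double f) (<ᵇ-true 2f<ᵇ2d))
  d≤2f : d ≤ f + f
  d≤2f = halve-≤ {d} {f + f} (subst (d + d ≤_) (quadruple f) (<ᵇ-false 4f≮ᵇ2d))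
  k : ℕ
  k = d ∸ f
  d≡k+f : d ≡ k + f
  d≡k+f = sym (m∸n+n≡m (<⇒≤ f<d))
  k≤f : k ≤ f
  k≤f = +-cancelʳ-≤ f k f (subst (_≤ f + f) d≡k+f d≤2f)

large-regime : ∀ {d f} → (4 * f <ᵇ d + d) ≡ false → (2 * f <ᵇ d + d) ≡ false → Regime d f
large-regime {d} {f} 4f≮ᵇ2d 2f≮ᵇ2d = large d≤f bound-here
  where
  bound-here : bound (suc (d + d)) f ≡ 1
  bound-here rewrite 4f≮ᵇ2d | 2f≮ᵇ2d = refl
  d≤f : d ≤ f
  d≤f = halve-≤ {d} {f} (subst (d + d ≤_) (double f) (<ᵇ-false 2f≮ᵇ2d))

regime : ∀ d f → Regime d f
regime d f with 4 * f <ᵇ d + d in 4f<ᵇ2d | 2 * f <ᵇ d + d in 2f<ᵇ2d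
... | true  | _     = small-regime 4f<ᵇ2d
... | false | true  = medium-regime 4f<ᵇ2d 2f<ᵇ2d
... | false | false = large-regime 4f<ᵇ2d 2f<ᵇ2d

open Circulant using (plan→β)
open Plans using (small-plan; medium-plan; large-plan)

circulant-attains-bound : ∀ d f → β→K≤ (suc (d + d)) f (bound (suc (d + d)) f)
circulant-attains-bound d f with regime d f
... | small r d≡f+r+f b≡    = subst (β→K≤ _ f) (sym b≡) (plan→β d (small-plan d d≡f+r+f))
... | medium k d≡k+f k≤f b≡ = subst (β→K≤ _ f) (sym b≡) (plan→β d (medium-plan d d≡k+f k≤f))
... | large d≤f b≡          = subst (β→K≤ _ f) (sym b≡) (plan→β d (large-plan d d≤f))

odd-form : ∀ {n} → n % 2 ≡ 1 → n ≡ suc (n / 2 + n / 2)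
odd-form {n} n%2≡1 =
  trans (m≡m%n+[m/n]*n n 2) (cong₂ _+_ n%2≡1 (trans (*-comm (n / 2) 2) (double (n / 2))))

proposition3p3 : (n f : ℕ) → 3 ≤ n → n % 2 ≡ 1 → 1 ≤ f → β→K≤ n f (bound n f)
proposition3p3 n f _ n-odd _ =
  subst (λ m → β→K≤ m f (bound m f)) (sym (odd-form n-odd)) (circulant-attains-bound (n / 2) f)
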